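{- Let $\mathtt{At}$ be a countable set of atomic formulas and $\Phi_0$ the set of Boolean formulas over $\mathtt{At}$. The modal axiom schema $$\big(\neg\square\neg(\phi\wedge\psi)\wedge B((\phi\wedge\psi)>\chi)\big)\rightarrow B\big(\phi>(\psi\rightarrow\chi)\big)\qquad(\phi,\psi,\chi\in\Phi_0)$$ corresponds to the following property of Kripke-Lewis frames $\langle S,\mathcal B,f\rangle$: $(P\ast7)$: for all $s\in S$ and all $E,F,G\subseteq S$ with $E\cap F\neq\varnothing$, if $f(s',E\cap F)\subseteq G$ for every $s'\in\mathcal B(s)$, then $f(s',E)\cap F\subseteq G$ for every $s'\in\mathcal B(s)$. That is: (1) the schema is valid on every frame satisfying $(P\ast7)$, and (2) on every frame violating $(P\ast7)$ the schema is not valid.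
   Context: $\Phi_0$ is built from $\mathtt{At}$ using $\neg$ and $\vee$ (with $\rightarrow,\wedge,\leftrightarrow$ defined as usual). A Kripke-Lewis frame is a triple $\langle S,\mathcal B,f\rangle$ where $S$ is a set of states, $\mathcal B\subseteq S\times S$ is a serial relation, $\mathcal B(s)=\{s':s\mathcal Bs'\}$, and $f:S\times(2^S\setminus\{\varnothing\})\to 2^S$ is an arbitrary function (no further properties assumed). A model is a frame together with a valuation $V:\mathtt{At}\to 2^S$. Truth at a state $s$: $s\models p$ iff $s\in V(p)$ for atoms; $\neg,\vee$ classical; $\Vert\phi\Vert=\{s:s\models\phi\}$. For $\phi\in\Phi_0$, $s\models\square\phi$ iff $\Vert\phi\Vert=S$. For $\phi,\psi\in\Phi_0$, $s\models\phi>\psi$ iff either $\Vert\phi\Vert=\varnothing$, or $\Vert\phi\Vert\neq\varnothing$ and $f(s,\Vert\phi\Vert)\subseteq\Vert\psi\Vert$. For $\phi$ a Boolean combination of formulas of $\Phi_0$ and conditionals $\alpha>\beta$ ($\alpha,\beta\in\Phi_0$), $s\models B\phi$ iff $\mathcal B(s)\subseteq\Vert\phi\Vert$. A schema is valid on a frame if every instance is true at every state of every model based on that frame. -}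

module Defs where

open import Data.Nat using (ℕ)
open import Data.Bool using (Bool; true; false; not; _∧_; _∨_)
open import Data.Product using (Σ; ∃; _×_; _,_)
open import Relation.Binary.PropositionalEquality using (_≡_)
open import Relation.Nullary using (¬_)

At : Set
At = ℕ

data Φ₀ : Set where
  atom : At → Φ₀
  ¬₀_  : Φ₀ → Φ₀
  _∨₀_ : Φ₀ → Φ₀ → Φ₀

_∧₀_ : Φ₀ → Φ₀ → Φ₀
φ ∧₀ ψ = ¬₀ ((¬₀ φ) ∨₀ (¬₀ ψ))

_→₀_ : Φ₀ → Φ₀ → Φ₀
φ →₀ ψ = (¬₀ φ) ∨₀ ψ

data Φ₁ : Set where
  base₁ : Φ₀ → Φ₁
  _>₁_  : Φ₀ → Φ₀ → Φ₁
  ¬₁_   : Φ₁ → Φ₁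
  _∨₁_  : Φ₁ → Φ₁ → Φ₁

data Form : Set where
  prop : Φ₀ → Form
  □_   : Φ₀ → Form
  _>_  : Φ₀ → Φ₀ → Form
  B_   : Φ₁ → Form
  ¬ᶠ_  : Form → Form
  _∨ᶠ_ : Form → Form → Form

_∧ᶠ_ : Form → Form → Form
a ∧ᶠ b = ¬ᶠ ((¬ᶠ a) ∨ᶠ (¬ᶠ b))

_→ᶠ_ : Form → Form → Form
a →ᶠ b = (¬ᶠ a) ∨ᶠ b

-- Subsets of S are characteristic functions S → Bool (classical powerset).
module _ {S : Set} where
  _∩_ : (S → Bool) → (S → Bool) → (S → Bool)
  (E ∩ F) x = E x ∧ F x

  _⊆_ : (S → Bool) → (S → Bool) → Set
  E ⊆ F = ∀ x → E x ≡ true → F x ≡ true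

  Empty : (S → Bool) → Set
  Empty E = ∀ x → E x ≡ false

  Full : (S → Bool) → Set
  Full E = ∀ x → E x ≡ true

  _≐_ : (S → Bool) → (S → Bool) → Set
  E ≐ F = ∀ x → E x ≡ F x

-- Kripke–Lewis frame ⟨S, ℬ, f⟩.  f is given on all subsets (its values on ∅
-- are never used).  f-ext says f is a function of the *set* E, i.e. it
-- respects extensional equality of characteristic functions.
record Frame : Set₁ where
  field
    S      : Set
    ℬ      : S → S → Set
    serial : ∀ s → ∃ λ s' → ℬ s s'
    f      : S → (S → Bool) → (S → Bool)
    f-ext  : ∀ s E E' → E ≐ E' → f s E ≐ f s E'

P*7 : Frame → Set
P*7 Fr = ∀ (s : S) (E F G : S → Bool) →
         ¬ Empty (E ∩ F) →
         (∀ s' → ℬ s s' → f s' (E ∩ F) ⊆ G) →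
         (∀ s' → ℬ s s' → (f s' E ∩ F) ⊆ G)
  where open Frame Fr

_⊎c_ : Set → Set → Set
P ⊎c Q = ¬ ((¬ P) × (¬ Q))

module Semantics (Fr : Frame) (V : At → Frame.S Fr → Bool) where
  open Frame Fr

  ⟦_⟧₀ : Φ₀ → S → Bool
  ⟦ atom p ⟧₀ s = V p s
  ⟦ ¬₀ φ ⟧₀ s = not (⟦ φ ⟧₀ s)
  ⟦ φ ∨₀ ψ ⟧₀ s = ⟦ φ ⟧₀ s ∨ ⟦ ψ ⟧₀ s

  condTrue : S → Φ₀ → Φ₀ → Set
  condTrue s φ ψ = Empty ⟦ φ ⟧₀ ⊎c ((¬ Empty ⟦ φ ⟧₀) × (f s ⟦ φ ⟧₀ ⊆ ⟦ ψ ⟧₀))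

  _⊨₁_ : S → Φ₁ → Set
  s ⊨₁ base₁ φ = ⟦ φ ⟧₀ s ≡ true
  s ⊨₁ (φ >₁ ψ) = condTrue s φ ψ
  s ⊨₁ (¬₁ θ) = ¬ (s ⊨₁ θ)
  s ⊨₁ (θ ∨₁ θ') = (s ⊨₁ θ) ⊎c (s ⊨₁ θ')

  _⊨_ : S → Form → Set
  s ⊨ prop φ = ⟦ φ ⟧₀ s ≡ true
  s ⊨ (□ φ) = Full ⟦ φ ⟧₀
  s ⊨ (φ > ψ) = condTrue s φ ψ
  s ⊨ (B θ) = ∀ s' → ℬ s s' → s' ⊨₁ θ
  s ⊨ (¬ᶠ a) = ¬ (s ⊨ a)
  s ⊨ (a ∨ᶠ b) = (s ⊨ a) ⊎c (s ⊨ b)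

schema : Φ₀ → Φ₀ → Φ₀ → Form
schema φ ψ χ =
  ((¬ᶠ (□ (¬₀ (φ ∧₀ ψ)))) ∧ᶠ (B ((φ ∧₀ ψ) >₁ χ)))
    →ᶠ (B (φ >₁ (ψ →₀ χ)))

ValidSchema : Frame → Set
ValidSchema Fr = ∀ (V : At → Frame.S Fr → Bool) (s : Frame.S Fr) (φ ψ χ : Φ₀) →
                 Semantics._⊨_ Fr V s (schema φ ψ χ)

{-# OPTIONS --safe #-}
-- Write E, F, G for the truth sets of φ, ψ, χ.  The instance of the schema at s says
-- exactly (P*7) at s for E, F, G: ¬□¬(φ∧ψ) says E ∩ F ≠ ∅; once ‖φ∧ψ‖ and hence ‖φ‖ are
-- nonempty, the conditionals reduce to f(s′,E ∩ F) ⊆ G and f(s′,E) ⊆ ‖ψ → χ‖, the latter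
-- being f(s′,E) ∩ F ⊆ G.  So (P*7) gives validity, and conversely a valuation letting
-- three atoms denote arbitrary E, F, G turns validity into (P*7).
module Submission where

open import Defs
open import Data.Bool using (Bool; true; false; not; _∧_; _∨_)
open import Data.Bool.Properties using (_≟_; ∧-zeroˡ)
open import Data.Product using (_×_; _,_; proj₂)
open import Function using (_∘_; _⇔_; mk⇔; Equivalence)
open import Relation.Binary.PropositionalEquality using (_≡_; refl; sym; trans; cong)
open import Relation.Nullary using (¬_)
open import Relation.Nullary.Decidable using (decidable-stable)
open import Relation.Nullary.Negation using (Stable; negated-stable)

open Equivalence using (to; from)

≡true-stable : ∀ {b} → Stable (b ≡ true)
≡true-stable {b} = decidable-stable (b ≟ true)

∧≡true⇔ : ∀ {a b} → a ∧ b ≡ true ⇔ (a ≡ true × b ≡ true)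
∧≡true⇔ {true}  = mk⇔ (λ b≡true → refl , b≡true) proj₂
∧≡true⇔ {false} = mk⇔ (λ ()) (λ ())

not≡true⇔ : ∀ {a} → not a ≡ true ⇔ a ≡ false
not≡true⇔ {true}  = mk⇔ (λ ()) (λ ())
not≡true⇔ {false} = mk⇔ (λ _ → refl) (λ _ → refl)

not∨≡true⇔ : ∀ {a b} → not a ∨ b ≡ true ⇔ (a ≡ true → b ≡ true)
not∨≡true⇔ {true}  = mk⇔ (λ b≡true _ → b≡true) (λ imp → imp refl)
not∨≡true⇔ {false} = mk⇔ (λ _ ()) (λ _ → refl)

private
  variable
    X : Set
    A A′ C : X → Bool

⊆-stable : Stable (A ⊆ C)
⊆-stable ¬¬A⊆C x Ax = ≡true-stable (λ ¬Cx → ¬¬A⊆C (λ A⊆C → ¬Cx (A⊆C x Ax)))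

⊆-respˡ-≐ : A ≐ A′ → A′ ⊆ C → A ⊆ C
⊆-respˡ-≐ A≐A′ A′⊆C x Ax = A′⊆C x (trans (sym (A≐A′ x)) Ax)

≐-sym : A ≐ A′ → A′ ≐ A
≐-sym A≐A′ x = sym (A≐A′ x)

Empty-resp-≐ : A ≐ A′ → Empty A′ → Empty A
Empty-resp-≐ A≐A′ A′-empty x = trans (A≐A′ x) (A′-empty x)

Full-not⇔Empty : Full (λ x → not (A x)) ⇔ Empty A
Full-not⇔Empty = mk⇔ (λ full x → not≡true⇔ .to (full x)) (λ empty x → not≡true⇔ .from (empty x))

∩-nonempty⇒nonemptyˡ : ¬ Empty (A ∩ C) → ¬ Empty A
∩-nonempty⇒nonemptyˡ {C = C} ne empty = ne (λ x → trans (cong (_∧ C x) (empty x)) (∧-zeroˡ (C x)))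

P*7-at : (Fr : Frame) → Frame.S Fr → (E F G : Frame.S Fr → Bool) → Set
P*7-at Fr s E F G = ¬ Empty (E ∩ F) →
                    (∀ s′ → ℬ s s′ → f s′ (E ∩ F) ⊆ G) →
                    (∀ s′ → ℬ s s′ → (f s′ E ∩ F) ⊆ G)
  where open Frame Fr

module _ (Fr : Frame) (V : At → Frame.S Fr → Bool) where
  open Frame Fr
  open Semantics Fr V

  ⊨₁-stable : ∀ {s} θ → Stable (s ⊨₁ θ)
  ⊨₁-stable (base₁ φ) = ≡true-stable
  ⊨₁-stable (φ >₁ ψ)  = negated-stable
  ⊨₁-stable (¬₁ θ)    = negated-stable
  ⊨₁-stable (θ ∨₁ θ′) = negated-stable

  -- Disjunction is interpreted by its negative translation, so truth is ¬¬-stable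
  -- and the defined connectives →ᶠ and ∧ᶠ behave classically.
  ⊨-stable : ∀ {s} a → Stable (s ⊨ a)
  ⊨-stable (prop φ)  = ≡true-stable
  ⊨-stable (□ φ) ¬¬full x = ≡true-stable (λ ¬φx → ¬¬full (λ full → ¬φx (full x)))
  ⊨-stable (φ > ψ)   = negated-stable
  ⊨-stable (B θ) ¬¬Bθ s′ sℬs′ = ⊨₁-stable θ (λ ¬θ → ¬¬Bθ (λ Bθ → ¬θ (Bθ s′ sℬs′)))
  ⊨-stable (¬ᶠ a)    = negated-stable
  ⊨-stable (a ∨ᶠ b)  = negated-stable

  ⊨→ᶠ⇔ : ∀ {s} a b → s ⊨ (a →ᶠ b) ⇔ (s ⊨ a → s ⊨ b)
  ⊨→ᶠ⇔ a b = mk⇔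
    (λ a→b sa → ⊨-stable b (λ ¬sb → a→b ((λ ¬sa → ¬sa sa) , ¬sb)))
    (λ imp (¬¬sa , ¬sb) → ¬¬sa (λ sa → ¬sb (imp sa)))

  ⊨∧ᶠ⇔ : ∀ {s} a b → s ⊨ (a ∧ᶠ b) ⇔ (s ⊨ a × s ⊨ b)
  ⊨∧ᶠ⇔ a b = mk⇔
    (λ a∧b → ⊨-stable a (λ ¬sa → a∧b (λ (¬¬¬sa , _) → ¬¬¬sa ¬sa))
           , ⊨-stable b (λ ¬sb → a∧b (λ (_ , ¬¬¬sb) → ¬¬¬sb ¬sb)))
    (λ (sa , sb) ¬a∨¬b → ¬a∨¬b ((λ ¬sa → ¬sa sa) , (λ ¬sb → ¬sb sb)))

  ⊨¬□¬⇔ : ∀ {s} φ → s ⊨ (¬ᶠ (□ (¬₀ φ))) ⇔ (¬ Empty ⟦ φ ⟧₀)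
  ⊨¬□¬⇔ φ = mk⇔
    (λ ¬full empty → ¬full (Full-not⇔Empty .from empty))
    (λ ¬empty full → ¬empty (Full-not⇔Empty .to full))

  condTrue⇔ : ∀ {s} φ ψ → ¬ Empty ⟦ φ ⟧₀ → condTrue s φ ψ ⇔ (f s ⟦ φ ⟧₀ ⊆ ⟦ ψ ⟧₀)
  condTrue⇔ φ ψ ne = mk⇔
    (λ cond → ⊆-stable (λ ¬sub → cond (ne , λ (_ , sub) → ¬sub sub)))
    (λ sub (_ , ¬sub) → ¬sub (ne , sub))

  ⟦∧₀⟧ : ∀ φ ψ → ⟦ φ ∧₀ ψ ⟧₀ ≐ (⟦ φ ⟧₀ ∩ ⟦ ψ ⟧₀)
  ⟦∧₀⟧ φ ψ x with ⟦ φ ⟧₀ x | ⟦ ψ ⟧₀ x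
  ... | true  | true  = refl
  ... | true  | false = refl
  ... | false | _     = refl

  ⊆⟦→₀⟧⇔ : ∀ {A} ψ χ → A ⊆ ⟦ ψ →₀ χ ⟧₀ ⇔ (A ∩ ⟦ ψ ⟧₀) ⊆ ⟦ χ ⟧₀
  ⊆⟦→₀⟧⇔ ψ χ = mk⇔
    (λ sub x Aψx → let (Ax , ψx) = ∧≡true⇔ .to Aψx in not∨≡true⇔ .to (sub x Ax) ψx)
    (λ sub x Ax → not∨≡true⇔ .from (λ ψx → sub x (∧≡true⇔ .from (Ax , ψx))))

  ⊨schema⇔P*7-at : ∀ s φ ψ χ → s ⊨ schema φ ψ χ ⇔ P*7-at Fr s ⟦ φ ⟧₀ ⟦ ψ ⟧₀ ⟦ χ ⟧₀
  ⊨schema⇔P*7-at s φ ψ χ = mk⇔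
    (λ imp ne premise →
       conclusion⇔ ne .to (schema⇔ .to imp (consistent⇔ .from ne , premise⇔ ne .from premise)))
    (λ p7 → schema⇔ .from λ (h , b) →
       let ne = consistent⇔ .to h in conclusion⇔ ne .from (p7 ne (premise⇔ ne .to b)))
    where
    E F G : S → Bool
    E = ⟦ φ ⟧₀
    F = ⟦ ψ ⟧₀
    G = ⟦ χ ⟧₀

    EF≐E∩F : ⟦ φ ∧₀ ψ ⟧₀ ≐ (E ∩ F)
    EF≐E∩F = ⟦∧₀⟧ φ ψ

    consistent premise conclusion : Form
    consistent = ¬ᶠ (□ (¬₀ (φ ∧₀ ψ)))
    premise    = B ((φ ∧₀ ψ) >₁ χ)
    conclusion = B (φ >₁ (ψ →₀ χ))

    schema⇔ : s ⊨ schema φ ψ χ ⇔ (s ⊨ consistent × s ⊨ premise → s ⊨ conclusion)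
    schema⇔ = mk⇔ (λ imp h → ⊨→ᶠ⇔ hyps conclusion .to imp (⊨∧ᶠ⇔ consistent premise .from h))
                  (λ imp → ⊨→ᶠ⇔ hyps conclusion .from (imp ∘ ⊨∧ᶠ⇔ consistent premise .to))
      where
      hyps : Form
      hyps = consistent ∧ᶠ premise

    consistent⇔ : s ⊨ consistent ⇔ (¬ Empty (E ∩ F))
    consistent⇔ = mk⇔
      (λ h → ⊨¬□¬⇔ {s} (φ ∧₀ ψ) .to h ∘ Empty-resp-≐ EF≐E∩F)
      (λ ne → ⊨¬□¬⇔ {s} (φ ∧₀ ψ) .from (ne ∘ Empty-resp-≐ (≐-sym EF≐E∩F)))

    premise⇔ : ¬ Empty (E ∩ F) → s ⊨ premise ⇔ (∀ s′ → ℬ s s′ → f s′ (E ∩ F) ⊆ G)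
    premise⇔ ne = mk⇔
      (λ b s′ sℬs′ → ⊆-respˡ-≐ (≐-sym (fEF≐fE∩F s′)) (condTrue⇔ (φ ∧₀ ψ) χ neEF .to (b s′ sℬs′)))
      (λ p s′ sℬs′ → condTrue⇔ (φ ∧₀ ψ) χ neEF .from (⊆-respˡ-≐ (fEF≐fE∩F s′) (p s′ sℬs′)))
      where
      neEF : ¬ Empty ⟦ φ ∧₀ ψ ⟧₀
      neEF = ne ∘ Empty-resp-≐ (≐-sym EF≐E∩F)
      fEF≐fE∩F : ∀ s′ → f s′ ⟦ φ ∧₀ ψ ⟧₀ ≐ f s′ (E ∩ F)
      fEF≐fE∩F s′ = f-ext s′ _ _ EF≐E∩F

    conclusion⇔ : ¬ Empty (E ∩ F) → s ⊨ conclusion ⇔ (∀ s′ → ℬ s s′ → (f s′ E ∩ F) ⊆ G)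
    conclusion⇔ ne = mk⇔
      (λ b s′ sℬs′ → ⊆⟦→₀⟧⇔ ψ χ .to (condTrue⇔ φ (ψ →₀ χ) neE .to (b s′ sℬs′)))
      (λ p s′ sℬs′ → condTrue⇔ φ (ψ →₀ χ) neE .from (⊆⟦→₀⟧⇔ ψ χ .from (p s′ sℬs′)))
      where
      neE : ¬ Empty E
      neE = ∩-nonempty⇒nonemptyˡ ne

P*7⇒ValidSchema : (Fr : Frame) → P*7 Fr → ValidSchema Fr
P*7⇒ValidSchema Fr p7 V s φ ψ χ = ⊨schema⇔P*7-at Fr V s φ ψ χ .from (p7 s _ _ _)

ValidSchema⇒P*7 : (Fr : Frame) → ValidSchema Fr → P*7 Fr
ValidSchema⇒P*7 Fr valid s E F G =
  ⊨schema⇔P*7-at Fr V s (atom 0) (atom 1) (atom 2) .to (valid V s (atom 0) (atom 1) (atom 2))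
  where
  V : At → Frame.S Fr → Bool
  V 0 = E
  V 1 = F
  V _ = G

proposition5 : ((Fr : Frame) → P*7 Fr → ValidSchema Fr)
               × ((Fr : Frame) → ¬ P*7 Fr → ¬ ValidSchema Fr)
proposition5 = P*7⇒ValidSchema , λ Fr ¬p7 → ¬p7 ∘ ValidSchema⇒P*7 Fr
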